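{- Let $L$ be a complete lattice, $f\colon L\to L$ monotone and $u\colon L\to L$ a monotone $f$-compatible function (i.e. $u\circ f\sqsubseteq f\circ u$). Let $\bar u(x)=\mu(\lambda y.\,u(y)\sqcup x)$. Then $\nu(f\circ u)\sqsubseteq\nu(f\circ\bar{u})=\nu f$. If moreover $u$ is continuous and strict, then $\mu(f\circ u)\sqsubseteq\mu(f\circ\bar{u})=\mu f$.
   Context: $\mu g,\nu g$ denote least and greatest fixpoints of monotone $g$. Continuous = preserves joins of directed sets; strict = maps $\bot$ to $\bot$. -}

module Defs where

open import Level using (Level; suc)
open import Data.Product using (Σ; ∃; _×_; _,_)
open import Data.Sum using (_⊎_)
open import Data.Empty.Polymorphic using (⊥)
open import Relation.Binary.Structures using (IsPartialOrder)

record CompleteLattice (ℓ : Level) : Set (suc ℓ) where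
  infix 4 _≈_ _≤_
  field
    Carrier        : Set ℓ
    _≈_            : Carrier → Carrier → Set ℓ
    _≤_            : Carrier → Carrier → Set ℓ
    isPartialOrder : IsPartialOrder _≈_ _≤_
    ⋁              : (Carrier → Set ℓ) → Carrier
    ⋁-upper        : (S : Carrier → Set ℓ) → ∀ x → S x → x ≤ ⋁ S
    ⋁-least        : (S : Carrier → Set ℓ) → ∀ z → (∀ x → S x → x ≤ z) → ⋁ S ≤ z

  ⋀ : (Carrier → Set ℓ) → Carrier
  ⋀ S = ⋁ (λ x → ∀ y → S y → x ≤ y)

  bot : Carrier
  bot = ⋁ (λ _ → ⊥)

  infixr 6 _⊔_
  _⊔_ : Carrier → Carrier → Carrier
  x ⊔ y = ⋁ (λ z → z ≈ x ⊎ z ≈ y)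

  -- μ g and ν g: least and greatest fixpoints of a monotone g (Knaster–Tarski)
  μ : (Carrier → Carrier) → Carrier
  μ g = ⋀ (λ x → g x ≤ x)

  ν : (Carrier → Carrier) → Carrier
  ν g = ⋁ (λ x → x ≤ g x)

  Monotone : (Carrier → Carrier) → Set ℓ
  Monotone g = ∀ {x y} → x ≤ y → g x ≤ g y

  Directed : (Carrier → Set ℓ) → Set ℓ
  Directed D = (∃ λ x → D x)
             × (∀ x y → D x → D y → ∃ λ z → D z × x ≤ z × y ≤ z)

  image : (Carrier → Carrier) → (Carrier → Set ℓ) → (Carrier → Set ℓ)
  image g D y = ∃ λ x → D x × y ≈ g x

  Continuous : (Carrier → Carrier) → Set (suc ℓ)
  Continuous g = (D : Carrier → Set ℓ) → Directed D → g (⋁ D) ≈ ⋁ (image g D)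

  Strict : (Carrier → Carrier) → Set ℓ
  Strict g = g bot ≈ bot

  Compatible : (Carrier → Carrier) → (Carrier → Carrier) → Set ℓ
  Compatible f u = ∀ x → u (f x) ≤ f (u x)

  closure : (Carrier → Carrier) → Carrier → Carrier
  closure u x = μ (λ y → u y ⊔ x)

-- The ν-part needs only that the closure ū is extensive and that, by compatibility, f maps
-- u-closed elements to u-closed elements: then ū (ν (f ∘ ū)) is a post-fixed point of f.
-- For the μ-part it suffices that μ f is u-closed.  The predicate "u x ≤ x" contains ⊥
-- (strictness), is closed under f (compatibility) and under directed joins (continuity);
-- Pataraia's constructive fixpoint theorem, applied inside this predicate, yields an
-- element of it that equals μ f.
module Submission where

open import Defs
open import Level using (Level)
open import Data.Product using (_×_; _,_; Σ; ∃; proj₁; proj₂)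
open import Data.Sum using (inj₁; inj₂)
open import Function using (_∘_; id)
open import Relation.Binary.Bundles using (Poset)
open import Relation.Binary.PropositionalEquality using (_≡_; refl)
open import Relation.Binary.Structures using (IsPartialOrder)

module CompleteLatticeProperties {ℓ : Level} (L : CompleteLattice ℓ) where
  open CompleteLattice L
  open IsPartialOrder isPartialOrder renaming (refl to ≤-refl)

  poset : Poset ℓ ℓ ℓ
  poset = record { isPartialOrder = isPartialOrder }

  open import Relation.Binary.Reasoning.PartialOrder poset

  bot-least : ∀ {x} → bot ≤ x
  bot-least {x} = ⋁-least _ x λ _ ()

  ⊔-upperˡ : ∀ {x y} → x ≤ x ⊔ y
  ⊔-upperˡ {x} = ⋁-upper _ x (inj₁ Eq.refl)

  ⊔-upperʳ : ∀ {x y} → y ≤ x ⊔ y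
  ⊔-upperʳ {y = y} = ⋁-upper _ y (inj₂ Eq.refl)

  ⊔-least : ∀ {x y z} → x ≤ z → y ≤ z → x ⊔ y ≤ z
  ⊔-least {z = z} x≤z y≤z = ⋁-least _ z λ
    { w (inj₁ w≈x) → trans (reflexive w≈x) x≤z
    ; w (inj₂ w≈y) → trans (reflexive w≈y) y≤z
    }

  ⊔-monoˡ : ∀ {x x′ y} → x ≤ x′ → x ⊔ y ≤ x′ ⊔ y
  ⊔-monoˡ x≤x′ = ⊔-least (trans x≤x′ ⊔-upperˡ) ⊔-upperʳ

  μ-least : ∀ g {y} → g y ≤ y → μ g ≤ y
  μ-least g {y} gy≤y = ⋁-least _ y λ x x≤pre → x≤pre y gy≤y

  μ-greatest : ∀ g {x} → (∀ y → g y ≤ y → x ≤ y) → x ≤ μ g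
  μ-greatest g {x} = ⋁-upper _ x

  μ-prefixed : ∀ {g} → Monotone g → g (μ g) ≤ μ g
  μ-prefixed {g} g-mono = μ-greatest g λ y gy≤y → trans (g-mono (μ-least g gy≤y)) gy≤y

  μ-mono : ∀ {g h} → (∀ x → g x ≤ h x) → μ g ≤ μ h
  μ-mono {g} {h} g≤h = μ-greatest h λ y hy≤y → μ-least g (trans (g≤h y) hy≤y)

  ν-greatest : ∀ g {x} → x ≤ g x → x ≤ ν g
  ν-greatest g {x} = ⋁-upper _ x

  ν-postfixed : ∀ {g} → Monotone g → ν g ≤ g (ν g)
  ν-postfixed {g} g-mono = ⋁-least _ _ λ x x≤gx → trans x≤gx (g-mono (ν-greatest g x≤gx))

  ν-mono : ∀ {g h} → (∀ x → g x ≤ h x) → ν g ≤ ν h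
  ν-mono {g} {h} g≤h = ⋁-least _ _ λ x x≤gx → ν-greatest h (trans x≤gx (g≤h x))

  Admissible : (Carrier → Set ℓ) → Set (Level.suc ℓ)
  Admissible P = ∀ D → Directed D → (∀ x → D x → P x) → P (⋁ D)

  -- Pataraia: the join of all monotone, P-preserving maps that are inflationary on P is
  -- again such a map, hence dominates f composed with it; at ⊥ it gives a prefixed point.
  module Pataraia
    {f : Carrier → Carrier} (f-mono : Monotone f)
    {P : Carrier → Set ℓ} (P-admissible : Admissible P) (P-bot : P bot)
    (P-f : ∀ {x} → P x → P (f x)) (P-postfixed : ∀ {x} → P x → x ≤ f x)
    where

    record Good (g : Carrier → Carrier) : Set ℓ where
      field
        mono         : Monotone g
        preserves    : ∀ {x} → P x → P (g x)
        inflationary : ∀ {x} → P x → x ≤ g x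
    open Good

    id-good : Good id
    id-good = record { mono = id ; preserves = id ; inflationary = λ _ → ≤-refl }

    ∘-good : ∀ {g h} → Good g → Good h → Good (g ∘ h)
    ∘-good g-good h-good = record
      { mono         = mono g-good ∘ mono h-good
      ; preserves    = preserves g-good ∘ preserves h-good
      ; inflationary = λ px → trans (inflationary h-good px)
                                    (inflationary g-good (preserves h-good px))
      }

    GoodImage : Carrier → Carrier → Set ℓ
    GoodImage x y = Σ (Carrier → Carrier) λ g → Good g × y ≡ g x

    GoodImage-directed : ∀ {x} → P x → Directed (GoodImage x)
    GoodImage-directed {x} px = (x , id , id-good , refl) , upper-bound
      where
      upper-bound : ∀ y z → GoodImage x y → GoodImage x z →
                    ∃ λ w → GoodImage x w × y ≤ w × z ≤ w
      upper-bound _ _ (g , g-good , refl) (h , h-good , refl) =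
          g (h x) , (g ∘ h , ∘-good g-good h-good , refl)
        , mono g-good (inflationary h-good px)
        , inflationary g-good (preserves h-good px)

    top : Carrier → Carrier
    top x = ⋁ (GoodImage x)

    top-greatest : ∀ {g} → Good g → ∀ x → g x ≤ top x
    top-greatest {g} g-good x = ⋁-upper _ (g x) (g , g-good , refl)

    top-good : Good top
    top-good = record
      { mono         = λ {x} {x′} x≤x′ → ⋁-least _ _ λ
          { _ (g , g-good , refl) → trans (mono g-good x≤x′) (top-greatest g-good x′) }
      ; preserves    = λ {x} px → P-admissible _ (GoodImage-directed px) λ
          { _ (g , g-good , refl) → preserves g-good px }
      ; inflationary = λ {x} _ → top-greatest id-good x
      }

    f∘top-good : Good (f ∘ top)
    f∘top-good = record
      { mono         = f-mono ∘ mono top-good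
      ; preserves    = P-f ∘ preserves top-good
      ; inflationary = λ px → trans (inflationary top-good px)
                                    (P-postfixed (preserves top-good px))
      }

    prefixed-point : ∃ λ s → P s × f s ≤ s
    prefixed-point = top bot , preserves top-good P-bot , top-greatest f∘top-good bot

  μ-induction : ∀ {f} → Monotone f →
                ∀ {P} → Admissible P → P bot → (∀ {x} → P x → P (f x)) →
                ∃ λ s → P s × s ≈ μ f
  μ-induction {f} f-mono {P} P-admissible P-bot P-f =
    equal-to-μ (Pataraia.prefixed-point f-mono Q-admissible Q-bot Q-f proj₁)
    where
    Q : Carrier → Set ℓ
    Q x = (x ≤ f x) × (x ≤ μ f) × P x

    Q-admissible : Admissible Q
    Q-admissible D D-directed D⊆Q =
        ⋁-least _ _ (λ x d → trans (proj₁ (D⊆Q x d)) (f-mono (⋁-upper D x d)))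
      , ⋁-least _ _ (λ x d → proj₁ (proj₂ (D⊆Q x d)))
      , P-admissible D D-directed (λ x d → proj₂ (proj₂ (D⊆Q x d)))

    Q-bot : Q bot
    Q-bot = bot-least , bot-least , P-bot

    Q-f : ∀ {x} → Q x → Q (f x)
    Q-f (x≤fx , x≤μf , px) = f-mono x≤fx , trans (f-mono x≤μf) (μ-prefixed f-mono) , P-f px

    equal-to-μ : (∃ λ s → Q s × f s ≤ s) → ∃ λ s → P s × s ≈ μ f
    equal-to-μ (s , (_ , s≤μf , ps) , fs≤s) = s , ps , antisym s≤μf (μ-least f fs≤s)

  closed-admissible : ∀ {u} → Continuous u → Admissible (λ x → u x ≤ x)
  closed-admissible {u} u-continuous D D-directed D-closed = begin
    u (⋁ D)          ≈⟨ u-continuous D D-directed ⟩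
    ⋁ (image u D)    ≤⟨ ⋁-least _ _ (λ { y (x , d , y≈ux) → begin
                          y      ≈⟨ y≈ux ⟩
                          u x    ≤⟨ D-closed x d ⟩
                          x      ≤⟨ ⋁-upper D x d ⟩
                          ⋁ D    ∎ }) ⟩
    ⋁ D              ∎

  compatible-preserves-closed : ∀ {f u} → Monotone f → Compatible f u →
                                ∀ {x} → u x ≤ x → u (f x) ≤ f x
  compatible-preserves-closed {f} {u} f-mono compatible {x} ux≤x = begin
    u (f x)  ≤⟨ compatible x ⟩
    f (u x)  ≤⟨ f-mono ux≤x ⟩
    f x      ∎

  module Closure {u : Carrier → Carrier} (u-mono : Monotone u) where

    closure-prefixed : ∀ x → u (closure u x) ⊔ x ≤ closure u x
    closure-prefixed x = μ-prefixed (⊔-monoˡ ∘ u-mono)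

    closure-extensive : ∀ x → x ≤ closure u x
    closure-extensive x = trans ⊔-upperʳ (closure-prefixed x)

    closure-closed : ∀ x → u (closure u x) ≤ closure u x
    closure-closed x = trans ⊔-upperˡ (closure-prefixed x)

    closure-least : ∀ {x y} → u y ≤ y → x ≤ y → closure u x ≤ y
    closure-least uy≤y x≤y = μ-least _ (⊔-least uy≤y x≤y)

    closure-mono : Monotone (closure u)
    closure-mono {x} {x′} x≤x′ =
      closure-least (closure-closed x′) (trans x≤x′ (closure-extensive x′))

    ≤-closure : ∀ x → u x ≤ closure u x
    ≤-closure x = trans (u-mono (closure-extensive x)) (closure-closed x)

  module Fixpoints
    {f u : Carrier → Carrier} (f-mono : Monotone f) (u-mono : Monotone u)
    (compatible : Compatible f u)
    where
    open Closure u-mono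

    ν-f∘u≤ν-f∘closure : ν (f ∘ u) ≤ ν (f ∘ closure u)
    ν-f∘u≤ν-f∘closure = ν-mono (f-mono ∘ ≤-closure)

    ν-f∘closure≈ν-f : ν (f ∘ closure u) ≈ ν f
    ν-f∘closure≈ν-f = antisym (begin
      z               ≤⟨ closure-extensive z ⟩
      closure u z     ≤⟨ ν-greatest f closure-postfixed ⟩
      ν f             ∎)
      (ν-mono (f-mono ∘ closure-extensive))
      where
      z : Carrier
      z = ν (f ∘ closure u)

      closure-postfixed : closure u z ≤ f (closure u z)
      closure-postfixed = closure-least
        (compatible-preserves-closed f-mono compatible (closure-closed z))
        (ν-postfixed (f-mono ∘ closure-mono))

    μ-f∘u≤μ-f∘closure : μ (f ∘ u) ≤ μ (f ∘ closure u)
    μ-f∘u≤μ-f∘closure = μ-mono (f-mono ∘ ≤-closure)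

    μ-closed : Continuous u → Strict u → u (μ f) ≤ μ f
    μ-closed u-continuous u-strict =
      transfer (μ-induction f-mono (closed-admissible u-continuous) (reflexive u-strict)
                            (compatible-preserves-closed f-mono compatible))
      where
      u-cong : ∀ {x y} → x ≈ y → u x ≈ u y
      u-cong x≈y = antisym (u-mono (reflexive x≈y)) (u-mono (reflexive (Eq.sym x≈y)))

      transfer : (∃ λ s → u s ≤ s × s ≈ μ f) → u (μ f) ≤ μ f
      transfer (s , us≤s , s≈μf) = begin
        u (μ f)  ≈⟨ u-cong (Eq.sym s≈μf) ⟩
        u s      ≤⟨ us≤s ⟩
        s        ≈⟨ s≈μf ⟩
        μ f      ∎

    μ-f∘closure≈μ-f : Continuous u → Strict u → μ (f ∘ closure u) ≈ μ f
    μ-f∘closure≈μ-f u-continuous u-strict = antisym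
      (μ-least (f ∘ closure u) (begin
        f (closure u (μ f))  ≤⟨ f-mono (closure-least (μ-closed u-continuous u-strict) ≤-refl) ⟩
        f (μ f)              ≤⟨ μ-prefixed f-mono ⟩
        μ f                  ∎))
      (μ-mono (f-mono ∘ closure-extensive))

corollary5p6 : {ℓ : Level} (L : CompleteLattice ℓ) →
    let open CompleteLattice L in
    (f u : Carrier → Carrier) → Monotone f → Monotone u → Compatible f u →
    ((ν (f ∘ u) ≤ ν (f ∘ closure u)) × (ν (f ∘ closure u) ≈ ν f))
    × (Continuous u → Strict u →
       (μ (f ∘ u) ≤ μ (f ∘ closure u)) × (μ (f ∘ closure u) ≈ μ f))
corollary5p6 L f u f-mono u-mono compatible =
    (ν-f∘u≤ν-f∘closure , ν-f∘closure≈ν-f)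
  , λ u-continuous u-strict →
      μ-f∘u≤μ-f∘closure , μ-f∘closure≈μ-f u-continuous u-strict
  where open CompleteLatticeProperties.Fixpoints L f-mono u-mono compatible
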